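{- Let $n$ be an odd positive integer and let $D^*_n = \langle x,t \mid x^n = t^4 = 1,\ t^{ -1}xt = x^{ -1}\rangle$. Then $D^*_n$ contains $(4n, 2n-1, n-1)$ sum sets, and these sum sets are type 2 with respect to the center $\{1, t^2\}$ of $D^*_n$.
   Context: For a finite group $X$ of order $w$, $T\subseteq X$ with $|T|=k$ is a $(w,k,\mu)$ sum set if every nonidentity element $a\in X$ admits exactly $\mu$ ordered pairs $(y_1,y_2)\in T\times T$ with $y_1y_2 = a$. For a normal subgroup $N$ of order $2$, a sum set $T$ is type 2 with respect to $N$ if $|T\cap N|=1$ and $T$ meets each other coset of $N$ in $0$ or $2$ elements. -}

module Defs where

open import Data.Nat using (ℕ; zero; suc; _+_; _∸_; _%_; NonZero)
open import Data.Nat.DivMod using (m%n<n)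
open import Data.Fin using (Fin; toℕ; fromℕ<)
open import Data.Fin.Properties using () renaming (_≟_ to _≟ᶠ_)
open import Data.Product using (_×_; _,_; proj₁; proj₂)
open import Data.Product.Properties using (≡-dec)
open import Data.Sum using (_⊎_)
open import Data.List using (List; length; filter; cartesianProduct)
open import Data.List.Relation.Unary.Unique.Propositional using (Unique)
open import Relation.Binary.PropositionalEquality using (_≡_; _≢_)
open import Relation.Binary.Definitions using (DecidableEquality)
open import Relation.Nullary.Decidable using (_⊎-dec_)

-- Sum sets and type-2 sum sets in a (finite) group given by its multiplication,
-- identity and decidable equality.  A subset T is a duplicate-free list.
module SumSets {X : Set} (_≟_ : DecidableEquality X) (_·_ : X → X → X) (ε : X) where

  pairCount : List X → X → ℕ
  pairCount T a = length (filter (λ p → (proj₁ p · proj₂ p) ≟ a) (cartesianProduct T T))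

  -- T is a (w,k,μ) sum set (w = |X| is fixed by the ambient group)
  IsSumSet : ℕ → ℕ → List X → Set
  IsSumSet k μ T = Unique T × length T ≡ k × (∀ a → a ≢ ε → pairCount T a ≡ μ)

  cosetCount : X → List X → X → ℕ
  cosetCount z T a = length (filter (λ y → (y ≟ a) ⊎-dec (y ≟ (a · z))) T)

  -- type 2 with respect to N = {ε , z}  (z central of order 2)
  IsType2 : X → List X → Set
  IsType2 z T = cosetCount z T ε ≡ 1
              × (∀ a → a ≢ ε → a ≢ z → (cosetCount z T a ≡ 0) ⊎ (cosetCount z T a ≡ 2))

-- The group D*_n = ⟨x,t | xⁿ = t⁴ = 1, t⁻¹xt = x⁻¹⟩ in normal form:
-- (i , j) represents x^i t^j, i ∈ ℤ/n, j ∈ ℤ/4, and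
-- x^a t^b · x^c t^d = x^(a + (-1)^b c) t^(b+d).
modN : (n : ℕ) .{{_ : NonZero n}} → ℕ → Fin n
modN n m = fromℕ< (m%n<n m n)

Dic : ℕ → Set
Dic n = Fin n × Fin 4

module _ (n : ℕ) .{{_ : NonZero n}} where

  _≟ᴰ_ : DecidableEquality (Dic n)
  _≟ᴰ_ = ≡-dec _≟ᶠ_ _≟ᶠ_

  _·ᴰ_ : Dic n → Dic n → Dic n
  (a , b) ·ᴰ (c , d) = modN n (toℕ a + sgn (toℕ b % 2)) , modN 4 (toℕ b + toℕ d)
    where
      sgn : ℕ → ℕ
      sgn zero    = toℕ c
      sgn (suc _) = n ∸ toℕ c

  εᴰ : Dic n
  εᴰ = modN n 0 , modN 4 0

  xᴰ tᴰ t²ᴰ : Dic n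
  xᴰ  = modN n 1 , modN 4 0
  tᴰ  = modN n 0 , modN 4 1
  t²ᴰ = modN n 0 , modN 4 2

-- Write n = 2m + 1 and let H = {1, …, m} ⊆ ℤ/n, so that ℤ/n is the disjoint union of {0}, H and −H.
-- Take T = {1} ∪ {xᵘtʲ : u ∈ H, j ∈ ℤ/4}: it has 4m + 1 = 2n − 1 elements, meets the coset {1, t²}
-- once and every other coset {g, gt²} in 0 or 2 elements.  The representations a = y₁y₂ of
-- a = xᶜtᵈ ≠ 1 are counted by asking, for each y₁ ∈ T, whether y₁⁻¹a ∈ T.  The element y₁ = 1
-- contributes [c ∈ H].  For fixed u ∈ H the four elements y₁ = xᵘtʲ give y₁⁻¹a = x^(±(c − u))t^(d − j),
-- each sign twice and the identity exactly when c = u, so they contribute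
-- [c = u] + 2([c − u ∈ H] + [u − c ∈ H]) = 2 − [c = u].  Summing over u ∈ H leaves 2m = n − 1.

module Submission where

open import Algebra.Bundles using (AbelianGroup)
import Algebra.Properties.AbelianGroup as AbelianGroupProperties
open import Algebra.Structures using (IsAbelianGroup)
open import Data.Empty using (⊥)
open import Data.Fin.Base using (Fin; toℕ)
open import Data.Fin.Patterns using (0F; 1F; 2F; 3F)
open import Data.Fin.Properties using (toℕ-fromℕ<; toℕ-injective; toℕ<n) renaming (_≟_ to _≟ᶠ_)
open import Data.List.Base using (List; []; _∷_; _++_; map; length; filter; cartesianProduct; applyDownFrom; allFin)
open import Data.List.Properties using (length-applyDownFrom; length-++; length-map; map-++; map-cong; map-∘)
open import Data.List.Relation.Unary.All using (All; []; _∷_)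
open import Data.List.Relation.Unary.AllPairs using (_∷_)
open import Data.List.Relation.Unary.Unique.Propositional using (Unique)
open import Data.List.Relation.Unary.Unique.Propositional.Properties using (applyDownFrom⁺₁; cartesianProduct⁺; allFin⁺)
open import Data.Nat.Base using (ℕ; zero; suc; _+_; _*_; _∸_; _≤_; _<_; s≤s; s≤s⁻¹; NonZero; >-nonZero⁻¹)
open import Data.Nat.DivMod using (_%_; _/_; m≡m%n+[m/n]*n; m%n<n; m%n%n≡m%n; %-distribˡ-+; n%n≡0; m<n⇒m%n≡m)
open import Data.Nat.ListAction using (sum)
open import Data.Nat.ListAction.Properties using (sum-++)
open import Data.Nat.Properties
  using ( +-assoc; +-comm; +-identityʳ; *-comm; *-identityʳ; *-zeroʳ; *-distribˡ-+; *-distribʳ-+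
        ; +-commutativeSemigroup; m∸n+n≡m; m+n∸n≡m; m≤m+n; m<n⇒0<n∸m; ∸-monoʳ-≤; ∸-monoʳ-<
        ; <⇒≤; <⇒≢; ≤∧≢⇒<; ≮⇒≥; n≢0⇒n>0; 1+n≢0; suc-injective; n<1+n; ≤-reflexive
        ; ≤-trans; <-trans; ≤-<-trans; _<?_; module ≤-Reasoning)
  renaming (_≟_ to _≟ℕ_)
open import Algebra.Properties.CommutativeSemigroup +-commutativeSemigroup using (interchange)
open import Data.Nat.Tactic.RingSolver using (solve-∀)
open import Data.Product.Base using (Σ; ∃-syntax; _×_; _,_; proj₁; proj₂)
open import Data.Sum.Base using (_⊎_; inj₁; inj₂; map₂)
open import Function.Base using (_∘_; id)
open import Function.Bundles using (_⇔_; mk⇔; Equivalence)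
open import Level using (Level; 0ℓ)
open import Relation.Binary.Definitions using (DecidableEquality)
open import Relation.Binary.PropositionalEquality
open import Relation.Nullary.Decidable using (Dec; yes; no; _⊎-dec_)
open import Relation.Nullary.Negation using (¬_; contradiction)
open import Relation.Unary using (Decidable)

open import Defs

private variable
  a b p q : Level
  A : Set a
  B : Set b
  P : Set p
  Q : Set q

𝟙 : Dec P → ℕ
𝟙 (yes _) = 1
𝟙 (no _)  = 0

𝟙-yes : P → (p? : Dec P) → 𝟙 p? ≡ 1
𝟙-yes p (yes _) = refl
𝟙-yes p (no ¬p) = contradiction p ¬p

𝟙-no : ¬ P → (p? : Dec P) → 𝟙 p? ≡ 0
𝟙-no ¬p (yes p) = contradiction p ¬p
𝟙-no ¬p (no _)  = refl

𝟙-cong : P ⇔ Q → (p? : Dec P) (q? : Dec Q) → 𝟙 p? ≡ 𝟙 q?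
𝟙-cong P⇔Q p? (yes q) = 𝟙-yes (Equivalence.from P⇔Q q) p?
𝟙-cong P⇔Q p? (no ¬q) = 𝟙-no (¬q ∘ Equivalence.to P⇔Q) p?

𝟙-⊎ : (P → Q → ⊥) → (p? : Dec P) (q? : Dec Q) → 𝟙 (p? ⊎-dec q?) ≡ 𝟙 p? + 𝟙 q?
𝟙-⊎ disjoint (yes p) (yes q) = contradiction q (disjoint p)
𝟙-⊎ disjoint (yes _) (no _)  = refl
𝟙-⊎ disjoint (no _)  (yes _) = refl
𝟙-⊎ disjoint (no _)  (no _)  = refl

𝟙-, : {x x′ : A} {y y′ : B} (xy? : Dec ((x , y) ≡ (x′ , y′))) (x? : Dec (x ≡ x′)) (y? : Dec (y ≡ y′)) →
      𝟙 xy? ≡ 𝟙 x? * 𝟙 y?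
𝟙-, xy? (yes refl) (yes refl) = 𝟙-yes refl xy?
𝟙-, xy? (yes _)    (no y≢y′)  = 𝟙-no (y≢y′ ∘ cong proj₂) xy?
𝟙-, xy? (no x≢x′)  _          = 𝟙-no (x≢x′ ∘ cong proj₁) xy?

∑ : List A → (A → ℕ) → ℕ
∑ xs f = sum (map f xs)

syntax ∑ xs (λ x → e) = ∑[ x ∈ xs ] e

∑-cong : {f g : A → ℕ} → (∀ x → f x ≡ g x) → ∀ xs → ∑ xs f ≡ ∑ xs g
∑-cong f≗g xs = cong sum (map-cong f≗g xs)

∑-++ : ∀ xs ys (f : A → ℕ) → ∑ (xs ++ ys) f ≡ ∑ xs f + ∑ ys f
∑-++ xs ys f = trans (cong sum (map-++ f xs ys)) (sum-++ (map f xs) (map f ys))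

∑-+ : ∀ xs (f g : A → ℕ) → ∑[ x ∈ xs ] (f x + g x) ≡ ∑ xs f + ∑ xs g
∑-+ []       f g = refl
∑-+ (x ∷ xs) f g = trans (cong (f x + g x +_) (∑-+ xs f g)) (interchange (f x) (g x) _ _)

∑-*ˡ : ∀ k xs (f : A → ℕ) → ∑[ x ∈ xs ] (k * f x) ≡ k * ∑ xs f
∑-*ˡ k []       f = sym (*-zeroʳ k)
∑-*ˡ k (x ∷ xs) f = trans (cong (k * f x +_) (∑-*ˡ k xs f)) (sym (*-distribˡ-+ k (f x) _))

∑-*ʳ : ∀ k xs (f : A → ℕ) → ∑[ x ∈ xs ] (f x * k) ≡ ∑ xs f * k
∑-*ʳ k []       f = refl
∑-*ʳ k (x ∷ xs) f = trans (cong (f x * k +_) (∑-*ʳ k xs f)) (sym (*-distribʳ-+ k (f x) _))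

∑-const : ∀ k (xs : List A) → ∑[ x ∈ xs ] k ≡ length xs * k
∑-const k []       = refl
∑-const k (x ∷ xs) = cong (k +_) (∑-const k xs)

∑-cartesianProduct : ∀ xs ys (f : A × B → ℕ) →
                     ∑ (cartesianProduct xs ys) f ≡ ∑[ x ∈ xs ] ∑[ y ∈ ys ] f (x , y)
∑-cartesianProduct []       ys f = refl
∑-cartesianProduct (x ∷ xs) ys f = begin
  ∑ (map (x ,_) ys ++ cartesianProduct xs ys) f                  ≡⟨ ∑-++ (map (x ,_) ys) _ f ⟩
  ∑ (map (x ,_) ys) f + ∑ (cartesianProduct xs ys) f             ≡⟨ cong₂ _+_ (cong sum (sym (map-∘ ys))) (∑-cartesianProduct xs ys f) ⟩
  ∑[ y ∈ ys ] f (x , y) + ∑[ x′ ∈ xs ] ∑[ y ∈ ys ] f (x′ , y)    ∎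
  where open ≡-Reasoning

length-filter≡∑𝟙 : {P : A → Set p} (P? : Decidable P) → ∀ xs → length (filter P? xs) ≡ ∑[ x ∈ xs ] 𝟙 (P? x)
length-filter≡∑𝟙 P? []       = refl
length-filter≡∑𝟙 P? (x ∷ xs) with P? x
... | yes _ = cong suc (length-filter≡∑𝟙 P? xs)
... | no _  = length-filter≡∑𝟙 P? xs

length-cartesianProduct : ∀ (xs : List A) (ys : List B) → length (cartesianProduct xs ys) ≡ length xs * length ys
length-cartesianProduct []       ys = refl
length-cartesianProduct (x ∷ xs) ys =
  trans (length-++ (map (x ,_) ys)) (cong₂ _+_ (length-map (x ,_) ys) (length-cartesianProduct xs ys))

multiplicity : DecidableEquality A → List A → A → ℕ
multiplicity _≟_ xs v = ∑[ y ∈ xs ] 𝟙 (y ≟ v)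

multiplicity≡0⇒∉ : (_≟_ : DecidableEquality A) → ∀ xs {v} → multiplicity _≟_ xs v ≡ 0 → All (v ≢_) xs
multiplicity≡0⇒∉ _≟_ []       _ = []
multiplicity≡0⇒∉ _≟_ (y ∷ ys) {v} eq with y ≟ v
... | no y≢v = ≢-sym y≢v ∷ multiplicity≡0⇒∉ _≟_ ys eq

multiplicity-cartesianProduct :
  (_≟₁_ : DecidableEquality A) (_≟₂_ : DecidableEquality B) (_≟_ : DecidableEquality (A × B)) →
  ∀ xs ys x y → multiplicity _≟_ (cartesianProduct xs ys) (x , y) ≡ multiplicity _≟₁_ xs x * multiplicity _≟₂_ ys y
multiplicity-cartesianProduct _≟₁_ _≟₂_ _≟_ xs ys x y = begin
  ∑ (cartesianProduct xs ys) (λ z → 𝟙 (z ≟ (x , y)))        ≡⟨ ∑-cartesianProduct xs ys _ ⟩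
  ∑[ x′ ∈ xs ] ∑[ y′ ∈ ys ] 𝟙 ((x′ , y′) ≟ (x , y))         ≡⟨ ∑-cong (λ x′ → ∑-cong (λ y′ → 𝟙-, _ (x′ ≟₁ x) (y′ ≟₂ y)) ys) xs ⟩
  ∑[ x′ ∈ xs ] ∑[ y′ ∈ ys ] (𝟙 (x′ ≟₁ x) * 𝟙 (y′ ≟₂ y))    ≡⟨ ∑-cong (λ x′ → ∑-*ˡ (𝟙 (x′ ≟₁ x)) ys _) xs ⟩
  ∑[ x′ ∈ xs ] (𝟙 (x′ ≟₁ x) * multiplicity _≟₂_ ys y)      ≡⟨ ∑-*ʳ _ xs _ ⟩
  multiplicity _≟₁_ xs x * multiplicity _≟₂_ ys y          ∎
  where open ≡-Reasoning

[m%n+k]%n≡[m+k]%n : ∀ m k n .{{_ : NonZero n}} → (m % n + k) % n ≡ (m + k) % n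
[m%n+k]%n≡[m+k]%n m k n = begin
  (m % n + k) % n          ≡⟨ %-distribˡ-+ (m % n) k n ⟩
  (m % n % n + k % n) % n  ≡⟨ cong (λ r → (r + k % n) % n) (m%n%n≡m%n m n) ⟩
  (m % n + k % n) % n      ≡⟨ %-distribˡ-+ m k n ⟨
  (m + k) % n              ∎
  where open ≡-Reasoning

[m+k%n]%n≡[m+k]%n : ∀ m k n .{{_ : NonZero n}} → (m + k % n) % n ≡ (m + k) % n
[m+k%n]%n≡[m+k]%n m k n = begin
  (m + k % n) % n  ≡⟨ cong (_% n) (+-comm m (k % n)) ⟩
  (k % n + m) % n  ≡⟨ [m%n+k]%n≡[m+k]%n k m n ⟩
  (k + m) % n      ≡⟨ cong (_% n) (+-comm k m) ⟩
  (m + k) % n      ∎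
  where open ≡-Reasoning

module ℤMod (n : ℕ) .{{_ : NonZero n}} where

  0ₙ : Fin n
  0ₙ = modN n 0

  infixl 6 _⊕_
  _⊕_ : Fin n → Fin n → Fin n
  i ⊕ j = modN n (toℕ i + toℕ j)

  infix 8 ⊖_
  ⊖_ : Fin n → Fin n
  ⊖ i = modN n (n ∸ toℕ i)

  toℕ-modN : ∀ k → toℕ (modN n k) ≡ k % n
  toℕ-modN k = toℕ-fromℕ< (m%n<n k n)

  toℕ-modN-< : ∀ {k} → k < n → toℕ (modN n k) ≡ k
  toℕ-modN-< {k} k<n = trans (toℕ-modN k) (m<n⇒m%n≡m k<n)

  toℕ-0ₙ : toℕ 0ₙ ≡ 0
  toℕ-0ₙ = toℕ-modN-< (>-nonZero⁻¹ n)

  modN-cong-% : ∀ {k l} → k % n ≡ l % n → modN n k ≡ modN n l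
  modN-cong-% {k} {l} eq = toℕ-injective (trans (toℕ-modN k) (trans eq (sym (toℕ-modN l))))

  modN-toℕ : ∀ i → modN n (toℕ i) ≡ i
  modN-toℕ i = toℕ-injective (toℕ-modN-< (toℕ<n i))

  modN-+ˡ : ∀ k l → modN n (toℕ (modN n k) + l) ≡ modN n (k + l)
  modN-+ˡ k l = modN-cong-% (trans (cong (λ r → (r + l) % n) (toℕ-modN k)) ([m%n+k]%n≡[m+k]%n k l n))

  modN-+ʳ : ∀ k l → modN n (k + toℕ (modN n l)) ≡ modN n (k + l)
  modN-+ʳ k l = modN-cong-% (trans (cong (λ r → (k + r) % n) (toℕ-modN l)) ([m+k%n]%n≡[m+k]%n k l n))

  ⊕-assoc : ∀ i j k → (i ⊕ j) ⊕ k ≡ i ⊕ (j ⊕ k)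
  ⊕-assoc i j k = begin
    modN n (toℕ (i ⊕ j) + toℕ k)    ≡⟨ modN-+ˡ (toℕ i + toℕ j) (toℕ k) ⟩
    modN n (toℕ i + toℕ j + toℕ k)  ≡⟨ cong (modN n) (+-assoc (toℕ i) _ _) ⟩
    modN n (toℕ i + (toℕ j + toℕ k)) ≡⟨ modN-+ʳ (toℕ i) (toℕ j + toℕ k) ⟨
    modN n (toℕ i + toℕ (j ⊕ k))    ∎
    where open ≡-Reasoning

  ⊕-comm : ∀ i j → i ⊕ j ≡ j ⊕ i
  ⊕-comm i j = cong (modN n) (+-comm (toℕ i) (toℕ j))

  ⊕-identityˡ : ∀ i → 0ₙ ⊕ i ≡ i
  ⊕-identityˡ i = trans (cong (λ r → modN n (r + toℕ i)) toℕ-0ₙ) (modN-toℕ i)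

  ⊕-identityʳ : ∀ i → i ⊕ 0ₙ ≡ i
  ⊕-identityʳ i = trans (⊕-comm i 0ₙ) (⊕-identityˡ i)

  ⊖-inverseˡ : ∀ i → ⊖ i ⊕ i ≡ 0ₙ
  ⊖-inverseˡ i = begin
    modN n (toℕ (⊖ i) + toℕ i)   ≡⟨ modN-+ˡ (n ∸ toℕ i) (toℕ i) ⟩
    modN n (n ∸ toℕ i + toℕ i)   ≡⟨ cong (modN n) (m∸n+n≡m (<⇒≤ (toℕ<n i))) ⟩
    modN n n                     ≡⟨ modN-cong-% (trans (n%n≡0 n) (sym (m<n⇒m%n≡m (>-nonZero⁻¹ n)))) ⟩
    0ₙ                           ∎
    where open ≡-Reasoning

  +-isAbelianGroup : IsAbelianGroup _≡_ _⊕_ 0ₙ ⊖_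
  +-isAbelianGroup = record
    { isGroup = record
      { isMonoid = record
        { isSemigroup = record
          { isMagma = record { isEquivalence = isEquivalence ; ∙-cong = cong₂ _⊕_ }
          ; assoc   = ⊕-assoc
          }
        ; identity = ⊕-identityˡ , ⊕-identityʳ
        }
      ; inverse = ⊖-inverseˡ , λ i → trans (⊕-comm i (⊖ i)) (⊖-inverseˡ i)
      ; ⁻¹-cong = cong ⊖_
      }
    ; comm = ⊕-comm
    }

  +-abelianGroup : AbelianGroup 0ℓ 0ℓ
  +-abelianGroup = record { isAbelianGroup = +-isAbelianGroup }

  open AbelianGroupProperties +-abelianGroup public
    using (\\-leftDividesˡ; \\-leftDividesʳ)
    renaming (⁻¹-involutive to ⊖-involutive; ⁻¹-injective to ⊖-injective; ε⁻¹≈ε to ⊖0ₙ≡0ₙ)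

  ≡⇔0ₙ≡⊖⊕ : ∀ {i j} → i ≡ j ⇔ 0ₙ ≡ ⊖ i ⊕ j
  ≡⇔0ₙ≡⊖⊕ {i} {j} = mk⇔ (λ { refl → sym (⊖-inverseˡ i) })
    (λ eq → trans (sym (⊕-identityʳ i)) (trans (cong (i ⊕_) eq) (\\-leftDividesˡ i j)))

  0ₙ≡⊖⇔0ₙ≡ : ∀ {i} → 0ₙ ≡ ⊖ i ⇔ 0ₙ ≡ i
  0ₙ≡⊖⇔0ₙ≡ {i} = mk⇔ (λ eq → ⊖-injective {0ₙ} {i} (trans ⊖0ₙ≡0ₙ eq)) (λ { refl → sym ⊖0ₙ≡0ₙ })

  -- the residues k, …, 2, 1 (not 0, …, k - 1)
  residues : ℕ → List (Fin n)
  residues k = applyDownFrom (λ i → modN n (suc i)) k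

  toℕ-⊖ : ∀ i → toℕ i ≢ 0 → toℕ (⊖ i) ≡ n ∸ toℕ i
  toℕ-⊖ i i≢0 = toℕ-modN-< (∸-monoʳ-< (n≢0⇒n>0 i≢0) (<⇒≤ (toℕ<n i)))

  0ₙ≢ : ∀ {i} → toℕ i ≢ 0 → 0ₙ ≢ i
  0ₙ≢ i≢0 0ₙ≡i = i≢0 (trans (cong toℕ (sym 0ₙ≡i)) toℕ-0ₙ)

  modN≡⇔≡toℕ : ∀ {k v} → k < n → modN n k ≡ v ⇔ k ≡ toℕ v
  modN≡⇔≡toℕ k<n = mk⇔ (λ { refl → sym (toℕ-modN-< k<n) }) (λ { refl → toℕ-injective (toℕ-modN-< k<n) })

  multiplicity-residues-out : ∀ {k v} → k < n → toℕ v ≡ 0 ⊎ k < toℕ v → multiplicity _≟ᶠ_ (residues k) v ≡ 0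
  multiplicity-residues-out {zero}  _    _    = refl
  multiplicity-residues-out {suc k} {v} k<n v∉ = cong₂ _+_
    (𝟙-no (λ e → suc∉ v∉ (Equivalence.to (modN≡⇔≡toℕ k<n) e)) (modN n (suc k) ≟ᶠ v))
    (multiplicity-residues-out (<⇒≤ k<n) (map₂ (<-trans (n<1+n k)) v∉))
    where
      suc∉ : toℕ v ≡ 0 ⊎ suc k < toℕ v → suc k ≢ toℕ v
      suc∉ (inj₁ v≡0) eq = 1+n≢0 (trans eq v≡0)
      suc∉ (inj₂ k<v) eq = <⇒≢ k<v eq

  multiplicity-residues-in : ∀ {k v} → k < n → 1 ≤ toℕ v → toℕ v ≤ k → multiplicity _≟ᶠ_ (residues k) v ≡ 1
  multiplicity-residues-in {zero}  _ 1≤v v≤0 = contradiction (≤-trans 1≤v v≤0) λ ()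
  multiplicity-residues-in {suc k} {v} k<n 1≤v v≤1+k with toℕ v ≟ℕ suc k
  ... | yes v≡1+k = cong₂ _+_
    (𝟙-yes (Equivalence.from (modN≡⇔≡toℕ k<n) (sym v≡1+k)) (modN n (suc k) ≟ᶠ v))
    (multiplicity-residues-out (<⇒≤ k<n) (inj₂ (≤-reflexive (sym v≡1+k))))
  ... | no v≢1+k = cong₂ _+_
    (𝟙-no (v≢1+k ∘ sym ∘ Equivalence.to (modN≡⇔≡toℕ k<n)) (modN n (suc k) ≟ᶠ v))
    (multiplicity-residues-in (<⇒≤ k<n) 1≤v (s≤s⁻¹ (≤∧≢⇒< v≤1+k v≢1+k)))

  multiplicity-residues≤1 : ∀ {k} → k < n → ∀ v → multiplicity _≟ᶠ_ (residues k) v ≡ 0 ⊎ multiplicity _≟ᶠ_ (residues k) v ≡ 1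
  multiplicity-residues≤1 {k} k<n v with toℕ v ≟ℕ 0 | k <? toℕ v
  ... | yes v≡0 | _       = inj₁ (multiplicity-residues-out k<n (inj₁ v≡0))
  ... | no _    | yes k<v = inj₁ (multiplicity-residues-out k<n (inj₂ k<v))
  ... | no v≢0  | no k≮v  = inj₂ (multiplicity-residues-in k<n (n≢0⇒n>0 v≢0) (≮⇒≥ k≮v))

  residues-unique : ∀ {k} → k < n → Unique (residues k)
  residues-unique {k} k<n = applyDownFrom⁺₁ _ k injective
    where
      injective : ∀ {i j} → j < i → i < k → modN n (suc i) ≢ modN n (suc j)
      injective {i} {j} j<i i<k eq = <⇒≢ j<i (sym (suc-injective (begin
        suc i                  ≡⟨ Equivalence.to (modN≡⇔≡toℕ 1+i<n) eq ⟩
        toℕ (modN n (suc j))   ≡⟨ toℕ-modN-< (<-trans (s≤s j<i) 1+i<n) ⟩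
        suc j                  ∎)))
        where
          open ≡-Reasoning
          1+i<n = ≤-<-trans i<k k<n

module SumSetCounting {X : Set} (_≟_ : DecidableEquality X) (_·_ : X → X → X) (ε : X) where

  open SumSets _≟_ _·_ ε

  pairCount≡∑multiplicity : (_∖_ : X → X → X) →
    (∀ y a → y · (y ∖ a) ≡ a) → (∀ y z → y ∖ (y · z) ≡ z) →
    ∀ T a → pairCount T a ≡ ∑[ y ∈ T ] multiplicity _≟_ T (y ∖ a)
  pairCount≡∑multiplicity _∖_ ∖-leftDividesˡ ∖-leftDividesʳ T a = begin
    pairCount T a
      ≡⟨ length-filter≡∑𝟙 (λ p → (proj₁ p · proj₂ p) ≟ a) (cartesianProduct T T) ⟩
    ∑ (cartesianProduct T T) (λ p → 𝟙 ((proj₁ p · proj₂ p) ≟ a))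
      ≡⟨ ∑-cartesianProduct T T _ ⟩
    ∑[ y ∈ T ] ∑[ y′ ∈ T ] 𝟙 ((y · y′) ≟ a)
      ≡⟨ ∑-cong (λ y → ∑-cong (λ y′ → 𝟙-cong divides _ _) T) T ⟩
    ∑[ y ∈ T ] ∑[ y′ ∈ T ] 𝟙 (y′ ≟ (y ∖ a))
      ∎
    where
      open ≡-Reasoning
      divides : ∀ {y y′} → y · y′ ≡ a ⇔ y′ ≡ y ∖ a
      divides {y} {y′} = mk⇔ (λ { refl → sym (∖-leftDividesʳ y y′) }) (λ { refl → ∖-leftDividesˡ y a })

  cosetCount≡ : ∀ z T a → a ≢ a · z → cosetCount z T a ≡ multiplicity _≟_ T a + multiplicity _≟_ T (a · z)
  cosetCount≡ z T a a≢az = begin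
    cosetCount z T a                                ≡⟨ length-filter≡∑𝟙 (λ y → (y ≟ a) ⊎-dec (y ≟ (a · z))) T ⟩
    ∑[ y ∈ T ] 𝟙 ((y ≟ a) ⊎-dec (y ≟ (a · z)))     ≡⟨ ∑-cong (λ y → 𝟙-⊎ (λ { refl → a≢az }) (y ≟ a) _) T ⟩
    ∑[ y ∈ T ] (𝟙 (y ≟ a) + 𝟙 (y ≟ (a · z)))       ≡⟨ ∑-+ T _ _ ⟩
    multiplicity _≟_ T a + multiplicity _≟_ T (a · z) ∎
    where open ≡-Reasoning

module Dicyclic (n : ℕ) .{{_ : NonZero n}} where

  open ℤMod n
  module ℤ₄ = ℤMod 4

  infixl 7 _·_ _∖_
  _·_ : Dic n → Dic n → Dic n
  _·_ = _·ᴰ_ n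

  -- t⁻ʲ xᵏ tʲ = x^(twist j k)
  twist : Fin 4 → Fin n → Fin n
  twist 0F = id
  twist 1F = ⊖_
  twist 2F = id
  twist 3F = ⊖_

  twist-involutive : ∀ j k → twist j (twist j k) ≡ k
  twist-involutive 0F k = refl
  twist-involutive 1F k = ⊖-involutive k
  twist-involutive 2F k = refl
  twist-involutive 3F k = ⊖-involutive k

  twist-0ₙ : ∀ j → twist j 0ₙ ≡ 0ₙ
  twist-0ₙ 0F = refl
  twist-0ₙ 1F = ⊖0ₙ≡0ₙ
  twist-0ₙ 2F = refl
  twist-0ₙ 3F = ⊖0ₙ≡0ₙ

  ·-normal : ∀ u j k l → (u , j) · (k , l) ≡ (u ⊕ twist j k , j ℤ₄.⊕ l)
  ·-normal u 0F k l = refl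
  ·-normal u 1F k l = cong (_, 1F ℤ₄.⊕ l) (sym (modN-+ʳ (toℕ u) (n ∸ toℕ k)))
  ·-normal u 2F k l = refl
  ·-normal u 3F k l = cong (_, 3F ℤ₄.⊕ l) (sym (modN-+ʳ (toℕ u) (n ∸ toℕ k)))

  _∖_ : Dic n → Dic n → Dic n
  (u , j) ∖ (c , d) = twist j (⊖ u ⊕ c) , ℤ₄.⊖ j ℤ₄.⊕ d

  ∖-leftDividesˡ : ∀ y a → y · (y ∖ a) ≡ a
  ∖-leftDividesˡ (u , j) (c , d) = trans (·-normal u j _ _) (cong₂ _,_
    (trans (cong (u ⊕_) (twist-involutive j (⊖ u ⊕ c))) (\\-leftDividesˡ u c))
    (ℤ₄.\\-leftDividesˡ j d))

  ∖-leftDividesʳ : ∀ y z → y ∖ (y · z) ≡ z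
  ∖-leftDividesʳ (u , j) (k , l) = trans (cong ((u , j) ∖_) (·-normal u j k l)) (cong₂ _,_
    (trans (cong (twist j) (\\-leftDividesʳ u (twist j k))) (twist-involutive j k))
    (ℤ₄.\\-leftDividesʳ j l))

  ε∖ : ∀ a → εᴰ n ∖ a ≡ a
  ε∖ (c , d) = cong₂ _,_ (trans (cong (_⊕ c) ⊖0ₙ≡0ₙ) (⊕-identityˡ c)) (trans (cong (ℤ₄._⊕ d) ℤ₄.⊖0ₙ≡0ₙ) (ℤ₄.⊕-identityˡ d))

  ·t² : ∀ c d → (c , d) · t²ᴰ n ≡ (c , d ℤ₄.⊕ 2F)
  ·t² c d = trans (·-normal c d 0ₙ 2F) (cong (_, d ℤ₄.⊕ 2F) (trans (cong (c ⊕_) (twist-0ₙ d)) (⊕-identityʳ c)))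

-- The terms for y₁ = xᵘtʲ (j ∈ ℤ/4): z = [c = u], a = [c − u ∈ H], b = [u − c ∈ H], sⱼ = [j = d].
block-arithmetic : ∀ z a b s₀ s₁ s₂ s₃ → s₀ + (s₁ + (s₂ + (s₃ + 0))) ≡ 1 → a + b + z ≡ 1 →
  z * s₀ + a + (z * s₁ + b + (z * s₂ + a + (z * s₃ + b + 0))) + z ≡ 2
block-arithmetic z a b s₀ s₁ s₂ s₃ s≡1 a+b+z≡1 = begin
  z * s₀ + a + (z * s₁ + b + (z * s₂ + a + (z * s₃ + b + 0))) + z  ≡⟨ collect z a b s₀ s₁ s₂ s₃ ⟩
  z * (s₀ + (s₁ + (s₂ + (s₃ + 0)))) + 2 * (a + b) + z            ≡⟨ cong (λ s → z * s + 2 * (a + b) + z) s≡1 ⟩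
  z * 1 + 2 * (a + b) + z                                         ≡⟨ double z a b ⟩
  2 * (a + b + z)                                                 ≡⟨ cong (2 *_) a+b+z≡1 ⟩
  2                                                               ∎
  where
    open ≡-Reasoning
    collect : ∀ z a b s₀ s₁ s₂ s₃ →
      z * s₀ + a + (z * s₁ + b + (z * s₂ + a + (z * s₃ + b + 0))) + z ≡ z * (s₀ + (s₁ + (s₂ + (s₃ + 0)))) + 2 * (a + b) + z
    collect = solve-∀
    double : ∀ z a b → z * 1 + 2 * (a + b) + z ≡ 2 * (a + b + z)
    double = solve-∀

module DicyclicSumSet (m : ℕ) where

  n : ℕ
  n = suc (m + m)

  open ℤMod n
  open Dicyclic n
  open SumSets (_≟ᴰ_ n) _·_ (εᴰ n)
  open SumSetCounting (_≟ᴰ_ n) _·_ (εᴰ n)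

  m<n : m < n
  m<n = s≤s (m≤m+n m m)

  half : List (Fin n)
  half = residues m

  blocks : List (Dic n)
  blocks = cartesianProduct half (allFin 4)

  T : List (Dic n)
  T = εᴰ n ∷ blocks

  #half : Fin n → ℕ
  #half = multiplicity _≟ᶠ_ half

  #T : Dic n → ℕ
  #T = multiplicity (_≟ᴰ_ n) T

  #half-0ₙ : #half 0ₙ ≡ 0
  #half-0ₙ = multiplicity-residues-out m<n (inj₁ toℕ-0ₙ)

  half-partition : ∀ e → #half e + #half (⊖ e) + 𝟙 (0ₙ ≟ᶠ e) ≡ 1
  half-partition e with toℕ e ≟ℕ 0 | m <? toℕ e
  ... | yes e≡0 | _ with refl ← toℕ-injective {i = e} {j = 0ₙ} (trans e≡0 (sym toℕ-0ₙ)) =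
    cong₂ _+_ (cong₂ _+_ #half-0ₙ (trans (cong #half ⊖0ₙ≡0ₙ) #half-0ₙ)) (𝟙-yes refl (0ₙ ≟ᶠ 0ₙ))
  ... | no e≢0 | no m≮e = cong₂ _+_
    (cong₂ _+_ (multiplicity-residues-in m<n (n≢0⇒n>0 e≢0) (≮⇒≥ m≮e))
               (multiplicity-residues-out m<n (inj₂ m<⊖e)))
    (𝟙-no (0ₙ≢ e≢0) (0ₙ ≟ᶠ e))
    where
      m<⊖e : m < toℕ (⊖ e)
      m<⊖e = begin-strict
        m              <⟨ n<1+n m ⟩
        suc m          ≡⟨ m+n∸n≡m (suc m) m ⟨
        n ∸ m          ≤⟨ ∸-monoʳ-≤ n (≮⇒≥ m≮e) ⟩
        n ∸ toℕ e      ≡⟨ toℕ-⊖ e e≢0 ⟨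
        toℕ (⊖ e)      ∎
        where open ≤-Reasoning
  ... | no e≢0 | yes m<e = cong₂ _+_
    (cong₂ _+_ (multiplicity-residues-out m<n (inj₂ m<e))
               (multiplicity-residues-in m<n 1≤⊖e ⊖e≤m))
    (𝟙-no (0ₙ≢ e≢0) (0ₙ ≟ᶠ e))
    where
      1≤⊖e : 1 ≤ toℕ (⊖ e)
      1≤⊖e = subst (1 ≤_) (sym (toℕ-⊖ e e≢0)) (m<n⇒0<n∸m (toℕ<n e))
      ⊖e≤m : toℕ (⊖ e) ≤ m
      ⊖e≤m = begin
        toℕ (⊖ e)      ≡⟨ toℕ-⊖ e e≢0 ⟩
        n ∸ toℕ e      ≤⟨ ∸-monoʳ-≤ n m<e ⟩
        m + m ∸ m      ≡⟨ m+n∸n≡m m m ⟩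
        m              ∎
        where open ≤-Reasoning

  multiplicity-allFin4 : ∀ s → multiplicity _≟ᶠ_ (allFin 4) s ≡ 1
  multiplicity-allFin4 0F = refl
  multiplicity-allFin4 1F = refl
  multiplicity-allFin4 2F = refl
  multiplicity-allFin4 3F = refl

  multiplicity-blocks : ∀ x s → multiplicity (_≟ᴰ_ n) blocks (x , s) ≡ #half x
  multiplicity-blocks x s = begin
    multiplicity (_≟ᴰ_ n) blocks (x , s)      ≡⟨ multiplicity-cartesianProduct _≟ᶠ_ _≟ᶠ_ (_≟ᴰ_ n) half (allFin 4) x s ⟩
    #half x * multiplicity _≟ᶠ_ (allFin 4) s  ≡⟨ cong (#half x *_) (multiplicity-allFin4 s) ⟩
    #half x * 1                               ≡⟨ *-identityʳ (#half x) ⟩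
    #half x                                   ∎
    where open ≡-Reasoning

  #T-pair : ∀ x s → #T (x , s) ≡ 𝟙 (0ₙ ≟ᶠ x) * 𝟙 (ℤ₄.0ₙ ≟ᶠ s) + #half x
  #T-pair x s = cong₂ _+_ (𝟙-, (_≟ᴰ_ n (εᴰ n) (x , s)) (0ₙ ≟ᶠ x) (ℤ₄.0ₙ ≟ᶠ s)) (multiplicity-blocks x s)

  #T-nonidentity : ∀ {a} → a ≢ εᴰ n → #T a ≡ #half (proj₁ a)
  #T-nonidentity {x , s} a≢ε = cong₂ _+_ (𝟙-no (a≢ε ∘ sym) (_≟ᴰ_ n (εᴰ n) (x , s))) (multiplicity-blocks x s)

  #T-twist : ∀ j e s → #T (twist j e , s) ≡ 𝟙 (0ₙ ≟ᶠ e) * 𝟙 (ℤ₄.0ₙ ≟ᶠ s) + #half (twist j e)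
  #T-twist j e s = trans (#T-pair (twist j e) s) (cong (λ z → z * 𝟙 (ℤ₄.0ₙ ≟ᶠ s) + #half (twist j e)) (𝟙-twist j))
    where
      𝟙-twist : ∀ j → 𝟙 (0ₙ ≟ᶠ twist j e) ≡ 𝟙 (0ₙ ≟ᶠ e)
      𝟙-twist 0F = refl
      𝟙-twist 1F = 𝟙-cong 0ₙ≡⊖⇔0ₙ≡ _ _
      𝟙-twist 2F = refl
      𝟙-twist 3F = 𝟙-cong 0ₙ≡⊖⇔0ₙ≡ _ _

  ∑-𝟙-0₄ : ∀ d → ∑[ j ∈ allFin 4 ] 𝟙 (ℤ₄.0ₙ ≟ᶠ ℤ₄.⊖ j ℤ₄.⊕ d) ≡ 1
  ∑-𝟙-0₄ 0F = refl
  ∑-𝟙-0₄ 1F = refl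
  ∑-𝟙-0₄ 2F = refl
  ∑-𝟙-0₄ 3F = refl

  block : ∀ u c d → ∑[ j ∈ allFin 4 ] #T ((u , j) ∖ (c , d)) + 𝟙 (u ≟ᶠ c) ≡ 2
  block u c d = begin
    ∑[ j ∈ allFin 4 ] #T ((u , j) ∖ (c , d)) + 𝟙 (u ≟ᶠ c)
      ≡⟨ cong₂ _+_ (∑-cong (λ j → #T-twist j e (ℤ₄.⊖ j ℤ₄.⊕ d)) (allFin 4)) (𝟙-cong ≡⇔0ₙ≡⊖⊕ _ (0ₙ ≟ᶠ e)) ⟩
    ∑[ j ∈ allFin 4 ] (𝟙 (0ₙ ≟ᶠ e) * 𝟙 (ℤ₄.0ₙ ≟ᶠ ℤ₄.⊖ j ℤ₄.⊕ d) + #half (twist j e)) + 𝟙 (0ₙ ≟ᶠ e)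
      ≡⟨ block-arithmetic (𝟙 (0ₙ ≟ᶠ e)) (#half e) (#half (⊖ e)) (s 0F) (s 1F) (s 2F) (s 3F) (∑-𝟙-0₄ d) (half-partition e) ⟩
    2 ∎
    where
      open ≡-Reasoning
      e = ⊖ u ⊕ c
      s : Fin 4 → ℕ
      s j = 𝟙 (ℤ₄.0ₙ ≟ᶠ ℤ₄.⊖ j ℤ₄.⊕ d)

  pairCount-T : ∀ a → a ≢ εᴰ n → pairCount T a ≡ m + m
  pairCount-T a@(c , d) a≢ε = begin
    pairCount T a
      ≡⟨ pairCount≡∑multiplicity _∖_ ∖-leftDividesˡ ∖-leftDividesʳ T a ⟩
    #T (εᴰ n ∖ a) + ∑ blocks (λ y → #T (y ∖ a))
      ≡⟨ cong₂ _+_ (trans (cong #T (ε∖ a)) (#T-nonidentity a≢ε)) (∑-cartesianProduct half (allFin 4) _) ⟩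
    #half c + ∑[ u ∈ half ] blockCount u
      ≡⟨ +-comm (#half c) _ ⟩
    ∑[ u ∈ half ] blockCount u + #half c
      ≡⟨ ∑-+ half blockCount (λ u → 𝟙 (u ≟ᶠ c)) ⟨
    ∑[ u ∈ half ] (blockCount u + 𝟙 (u ≟ᶠ c))
      ≡⟨ ∑-cong (λ u → block u c d) half ⟩
    ∑[ u ∈ half ] 2
      ≡⟨ ∑-const 2 half ⟩
    length half * 2
      ≡⟨ cong (_* 2) (length-applyDownFrom _ m) ⟩
    m * 2
      ≡⟨ *-comm m 2 ⟩
    m + (m + 0)
      ≡⟨ cong (m +_) (+-identityʳ m) ⟩
    m + m ∎
    where
      open ≡-Reasoning
      blockCount : Fin n → ℕ
      blockCount u = ∑[ j ∈ allFin 4 ] #T ((u , j) ∖ a)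

  T-unique : Unique T
  T-unique = multiplicity≡0⇒∉ (_≟ᴰ_ n) _ (trans (multiplicity-blocks 0ₙ 0F) #half-0ₙ)
           ∷ cartesianProduct⁺ (residues-unique m<n) (allFin⁺ 4)

  T-length : length T ≡ 2 * n ∸ 1
  T-length = begin
    suc (length blocks)      ≡⟨ cong suc (length-cartesianProduct half (allFin 4)) ⟩
    suc (length half * 4)    ≡⟨ cong (λ k → suc (k * 4)) (length-applyDownFrom _ m) ⟩
    suc (m * 4)              ≡⟨ arith m ⟩
    2 * n ∸ 1                ∎
    where
      open ≡-Reasoning
      arith : ∀ m → suc (m * 4) ≡ m + m + suc (m + m + 0)
      arith = solve-∀

  cosetCount-T : ∀ c d → cosetCount (t²ᴰ n) T (c , d) ≡ #T (c , d) + #T (c , d ℤ₄.⊕ 2F)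
  cosetCount-T c d = trans (cosetCount≡ (t²ᴰ n) T (c , d) a≢at²) (cong (λ y → #T (c , d) + #T y) (·t² c d))
    where
      d≢d+2 : ∀ d → d ≢ d ℤ₄.⊕ 2F
      d≢d+2 0F ()
      d≢d+2 1F ()
      d≢d+2 2F ()
      d≢d+2 3F ()
      a≢at² : (c , d) ≢ (c , d) · t²ᴰ n
      a≢at² eq = d≢d+2 d (cong proj₂ (trans eq (·t² c d)))

  T-type2-ε : cosetCount (t²ᴰ n) T (εᴰ n) ≡ 1
  T-type2-ε = begin
    cosetCount (t²ᴰ n) T (0ₙ , 0F)                                ≡⟨ cosetCount-T 0ₙ 0F ⟩
    #T (0ₙ , 0F) + #T (0ₙ , 2F)                                   ≡⟨ cong₂ _+_ (#T-pair 0ₙ 0F) (#T-pair 0ₙ 2F) ⟩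
    𝟙 (0ₙ ≟ᶠ 0ₙ) * 1 + #half 0ₙ + (𝟙 (0ₙ ≟ᶠ 0ₙ) * 0 + #half 0ₙ)   ≡⟨ cong₂ (λ z h → z * 1 + h + (z * 0 + h)) (𝟙-yes refl (0ₙ ≟ᶠ 0ₙ)) #half-0ₙ ⟩
    1                                                             ∎
    where open ≡-Reasoning

  T-type2 : ∀ a → a ≢ εᴰ n → a ≢ t²ᴰ n → cosetCount (t²ᴰ n) T a ≡ 0 ⊎ cosetCount (t²ᴰ n) T a ≡ 2
  T-type2 (c , d) a≢ε a≢t² rewrite cosetCount-T c d | #T-pair c d | #T-pair c (d ℤ₄.⊕ 2F) with 0ₙ ≟ᶠ c
  ... | yes refl = inj₁ (t-or-t³ d a≢ε a≢t²)
    where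
      t-or-t³ : ∀ d → (0ₙ , d) ≢ εᴰ n → (0ₙ , d) ≢ t²ᴰ n →
                 1 * 𝟙 (ℤ₄.0ₙ ≟ᶠ d) + #half 0ₙ + (1 * 𝟙 (ℤ₄.0ₙ ≟ᶠ d ℤ₄.⊕ 2F) + #half 0ₙ) ≡ 0
      t-or-t³ 0F a≢ε _    = contradiction refl a≢ε
      t-or-t³ 1F _   _    = cong₂ _+_ #half-0ₙ #half-0ₙ
      t-or-t³ 2F _   a≢t² = contradiction refl a≢t²
      t-or-t³ 3F _   _    = cong₂ _+_ #half-0ₙ #half-0ₙ
  ... | no _ with multiplicity-residues≤1 m<n c
  ...   | inj₁ #c≡0 = inj₁ (cong₂ _+_ #c≡0 #c≡0)
  ...   | inj₂ #c≡1 = inj₂ (cong₂ _+_ #c≡1 #c≡1)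

  sumSet : Σ (List (Dic n)) λ T → IsSumSet (2 * n ∸ 1) (n ∸ 1) T × IsType2 (t²ᴰ n) T
  sumSet = T , (T-unique , T-length , pairCount-T) , (T-type2-ε , T-type2)

odd⇒≡1+m+m : ∀ n → n % 2 ≡ 1 → ∃[ m ] n ≡ suc (m + m)
odd⇒≡1+m+m n n%2≡1 = n / 2 , (begin
  n                          ≡⟨ m≡m%n+[m/n]*n n 2 ⟩
  n % 2 + n / 2 * 2          ≡⟨ cong₂ _+_ n%2≡1 (*-comm (n / 2) 2) ⟩
  suc (n / 2 + (n / 2 + 0))  ≡⟨ cong (λ k → suc (n / 2 + k)) (+-identityʳ (n / 2)) ⟩
  suc (n / 2 + n / 2)        ∎)
  where open ≡-Reasoning

theorem6p4 : (n : ℕ) .{{_ : NonZero n}} → n % 2 ≡ 1 →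
    Σ (List (Dic n)) (λ T →
      SumSets.IsSumSet (_≟ᴰ_ n) (_·ᴰ_ n) (εᴰ n) (2 * n ∸ 1) (n ∸ 1) T
      × SumSets.IsType2 (_≟ᴰ_ n) (_·ᴰ_ n) (εᴰ n) (t²ᴰ n) T)
theorem6p4 n n%2≡1 with m , refl ← odd⇒≡1+m+m n n%2≡1 = DicyclicSumSet.sumSet m
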